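{- Let $k\ge 1$. A word $w$ over a totally ordered alphabet is sortable by a stack of depth $k$ if and only if $w$ avoids the patterns $120$ and $k(k-1)\cdots 10$ (the strictly decreasing pattern of length $k+1$).
   Context: A word $w=w_1\cdots w_n$ contains a pattern $p=p_1\cdots p_m$ if there are indices $\alpha_1<\cdots<\alpha_m$ with $w_{\alpha_i}<w_{\alpha_j}$ iff $p_i<p_j$ and $w_{\alpha_i}=w_{\alpha_j}$ iff $p_i=p_j$; otherwise $w$ avoids $p$. A stack is a last-in first-out device: entries are read left to right; a push moves the next input entry onto the top of the stack, a pop moves the top entry to the end of the output. A stack of depth $k$ is a stack whose contents may, at every stage, contain entries of at most $k$ distinct values (arbitrarily many entries of equal value are allowed). A word is sortable by such a device if some admissible sequence of pushes and pops outputs all its entries in weakly increasing order. -}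

module Defs where

open import Data.Nat using (ℕ; _≤_; _<_; _≟_)
open import Data.Nat.Properties using (≤-totalOrder)
open import Data.List using (List; []; _∷_; _++_; [_]; length; lookup; deduplicate; reverse; upTo)
open import Data.Fin using (Fin) renaming (_<_ to _<ᶠ_)
open import Data.Product using (Σ; _×_; _,_)
open import Relation.Binary.PropositionalEquality using (_≡_)
open import Relation.Nullary using (¬_)
open import Function.Bundles using (_⇔_)
open import Relation.Binary.Construct.Closure.ReflexiveTransitive using (Star)
import Data.List.Relation.Unary.Sorted.TotalOrder as SortedTO

Word : Set
Word = List ℕ

Contains : Word → Word → Set
Contains w p =
  Σ (Fin (length p) → Fin (length w)) λ α →
    (∀ i j → i <ᶠ j → α i <ᶠ α j)
    × (∀ i j → (lookup w (α i) < lookup w (α j)) ⇔ (lookup p i < lookup p j))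
    × (∀ i j → (lookup w (α i) ≡ lookup w (α j)) ⇔ (lookup p i ≡ lookup p j))

Avoids : Word → Word → Set
Avoids w p = ¬ Contains w p

p120 : Word
p120 = 1 ∷ 2 ∷ 0 ∷ []

decPattern : ℕ → Word
decPattern k = reverse (upTo (Data.Nat.suc k))

distinct : List ℕ → ℕ
distinct s = length (deduplicate _≟_ s)

-- configuration: (remaining input, stack with top at head, output so far)
record Config : Set where
  constructor ⟨_,_,_⟩
  field
    input  : List ℕ
    stack  : List ℕ
    output : List ℕ

data Step (k : ℕ) : Config → Config → Set where
  push : ∀ {x inp st out} → distinct (x ∷ st) ≤ k →
         Step k ⟨ x ∷ inp , st , out ⟩ ⟨ inp , x ∷ st , out ⟩
  pop  : ∀ {x inp st out} →
         Step k ⟨ inp , x ∷ st , out ⟩ ⟨ inp , st , out ++ [ x ] ⟩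

Sortable : ℕ → Word → Set
Sortable k w =
  Σ (List ℕ) λ out →
    Star (Step k) ⟨ w , [] , [] ⟩ ⟨ [] , [] , out ⟩
    × SortedTO.Sorted ≤-totalOrder out

-- Both patterns are handled as sublists: an occurrence of 120 is a sublist b c a with
-- a < b < c, and an occurrence of k⋯10 is a strictly decreasing sublist of length k + 1.
--
-- Sufficiency is the greedy algorithm: before pushing the next input x, pop every stack
-- entry smaller than x.  Such an entry t is at most every later input y, for otherwise
-- t x y would be an occurrence of 120; and x then fits on the stack, for otherwise the
-- distinct values of the stack with x on top, read from the bottom, would form a
-- decreasing sublist of length k + 1.
--
-- Necessity is an invariant of every sorting run, established backwards from its end: the
-- stack is weakly increasing from the top, and the stack read from the bottom followed by
-- the remaining input avoids both patterns.  Popping an entry x, which is at most everything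
-- still to be output, can only create occurrences ending in x: of 120 only if two stacked
-- entries were out of order, of the decreasing pattern only if the stack held k + 1
-- distinct values.

{-# OPTIONS --safe #-}
module Submission where

open import Defs
open import Level using (Level)
open import Function using (_∘_; id; flip)
open import Function.Bundles using (_⇔_; mk⇔; Equivalence)
import Function.Properties.Equivalence as ⇔
open import Data.Empty using (⊥-elim)
open import Data.Product using (Σ-syntax; ∃-syntax; ∃₂; _×_; _,_; proj₁; proj₂; uncurry)
open import Data.Product.Function.NonDependent.Propositional using (_×-⇔_)
open import Data.Sum using (_⊎_; inj₁; inj₂)
open import Data.Nat as ℕ
  using (ℕ; zero; suc; _≤_; _<_; _>_; _≟_; _<?_; _≤?_; z≤n; z<s; s<s)
open import Data.Nat.Properties
  using (≤-trans; ≤-reflexive; <-trans; <-irrefl; <-asym; <-cmp; <⇒≤; <⇒≱; >⇒≢; ≤∧≢⇒<;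
         ≮⇒≥; ≰⇒>; 1+n≰n; n≮0)
open import Data.Fin as Fin using (Fin; zero; suc; inject≤; punchOut)
import Data.Fin.Properties as Fin
open import Data.List
  using (List; []; _∷_; _++_; [_]; length; lookup; reverse; _ʳ++_; tabulate; deduplicate;
         downFrom)
open import Data.List.Properties
  using (++-assoc; ++-identityʳ; unfold-reverse; ʳ++-defn; ++-ʳ++; length-reverse;
         length-tabulate; tabulate-cong; reverse-applyUpTo; length-downFrom)
open import Data.List.Relation.Unary.All as All using (All; []; _∷_)
import Data.List.Relation.Unary.All.Properties as All
open import Data.List.Relation.Unary.AllPairs as AllPairs using (AllPairs; []; _∷_)
import Data.List.Relation.Unary.AllPairs.Properties as AllPairs
open import Data.List.Relation.Unary.Any using (here; there; index)
import Data.List.Relation.Unary.Any.Properties as Any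
open import Data.List.Relation.Unary.Linked.Properties using (AllPairs⇒Linked; Linked⇒AllPairs)
open import Data.List.Relation.Unary.Unique.Propositional using (Unique)
open import Data.List.Relation.Unary.Unique.DecPropositional.Properties _≟_ using (deduplicate-!)
open import Data.List.Membership.Propositional using (_∈_)
open import Data.List.Membership.Propositional.Properties
  using (∈-lookup; ∈-deduplicate⁺; ∈-deduplicate⁻)
open import Data.List.Membership.Setoid.Properties using (index-injective)
open import Data.List.Relation.Binary.Sublist.Propositional
  using (_⊆_; []; _∷_; _∷ʳ_; ⊆-refl; ⊆-trans; from∈)
open import Data.List.Relation.Binary.Sublist.Propositional.Properties
  using (All-resp-⊆; Any-resp-⊆; ++⁺; ++⁺ˡ; ʳ++⁺; reverse⁻; filter-⊆; []⊆-universal)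
open import Data.List.Relation.Binary.Permutation.Propositional
  using (_↭_; ↭-refl; ↭-sym; ↭-trans; prep)
open import Data.List.Relation.Binary.Permutation.Propositional.Properties
  using (All-resp-↭; shift)
open import Relation.Binary.Core using (Rel)
open import Relation.Binary.Definitions using (Decidable; tri<; tri≈; tri>)
open import Relation.Binary.PropositionalEquality
  using (_≡_; _≢_; refl; sym; trans; cong; subst; subst₂; setoid)
open import Relation.Nullary using (¬_; yes; no; contradiction)
open import Relation.Binary.Construct.Closure.ReflexiveTransitive using (Star; ε; _◅_; _◅◅_)

private
  variable
    a ℓ : Level
    A : Set a
    R : Rel A ℓ
    x : A
    xs ys zs : List A
    k : ℕ
    st inp out fin : List ℕ

AllPairs-resp-⊆ : xs ⊆ ys → AllPairs R ys → AllPairs R xs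
AllPairs-resp-⊆ []         []         = []
AllPairs-resp-⊆ (_ ∷ʳ p)   (_ ∷ rys)  = AllPairs-resp-⊆ p rys
AllPairs-resp-⊆ (refl ∷ p) (ry ∷ rys) = All-resp-⊆ p ry ∷ AllPairs-resp-⊆ p rys

AllPairs-++⁻ʳ : ∀ xs → AllPairs R (xs ++ ys) → AllPairs R ys
AllPairs-++⁻ʳ []       rys       = rys
AllPairs-++⁻ʳ (_ ∷ xs) (_ ∷ rxs) = AllPairs-++⁻ʳ xs rxs

AllPairs-insert : ∀ xs → AllPairs R (xs ++ ys) → All (λ z → R z x) xs → All (R x) ys →
                  AllPairs R (xs ++ x ∷ ys)
AllPairs-insert []       rys         []           rx = rx ∷ rys
AllPairs-insert (_ ∷ xs) (rz ∷ rxys) (rzx ∷ rxsx) rx =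
  All.++⁺ (All.++⁻ˡ xs rz) (rzx ∷ All.++⁻ʳ xs rz) ∷ AllPairs-insert xs rxys rxsx rx

AllPairs-reverse⁺ : AllPairs R xs → AllPairs (flip R) (reverse xs)
AllPairs-reverse⁺ [] = []
AllPairs-reverse⁺ {xs = x ∷ xs} (rx ∷ rxs) rewrite unfold-reverse x xs =
  AllPairs.++⁺ (AllPairs-reverse⁺ rxs) ([] ∷ [])
               (All.tabulate λ y∈ → All.lookup rx (Any.reverse⁻ y∈) ∷ [])

AllPairs-lookup : AllPairs R xs → ∀ {i j} → i Fin.< j → R (lookup xs i) (lookup xs j)
AllPairs-lookup (rx ∷ _)  {zero}  {suc j} _   = All.lookup rx (∈-lookup j)
AllPairs-lookup (_ ∷ rxs) {suc i} {suc j} i<j = AllPairs-lookup rxs (ℕ.s<s⁻¹ i<j)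

Unique-lookup-injective : Unique xs → ∀ {i j} → lookup xs i ≡ lookup xs j → i ≡ j
Unique-lookup-injective u {i} {j} xᵢ≡xⱼ with Fin.<-cmp i j
... | tri< i<j _ _ = contradiction xᵢ≡xⱼ (AllPairs-lookup u i<j)
... | tri≈ _ i≡j _ = i≡j
... | tri> _ _ j<i = contradiction (sym xᵢ≡xⱼ) (AllPairs-lookup u j<i)

⊆-++-split : ∀ xs → zs ⊆ xs ++ ys →
             ∃₂ λ zs₁ zs₂ → zs ≡ zs₁ ++ zs₂ × zs₁ ⊆ xs × zs₂ ⊆ ys
⊆-++-split []       p = [] , _ , refl , [] , p
⊆-++-split (x ∷ xs) (.x ∷ʳ p) with ⊆-++-split xs p
... | zs₁ , zs₂ , refl , p₁ , p₂ = zs₁ , zs₂ , refl , x ∷ʳ p₁ , p₂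
⊆-++-split (x ∷ xs) (refl ∷ p) with ⊆-++-split xs p
... | zs₁ , zs₂ , refl , p₁ , p₂ = x ∷ zs₁ , zs₂ , refl , refl ∷ p₁ , p₂

⊆-ʳ++-∷-split : ∀ xs → zs ⊆ xs ʳ++ x ∷ ys →
                zs ⊆ xs ʳ++ ys
                ⊎ ∃₂ λ zs₁ zs₂ → zs ≡ zs₁ ++ x ∷ zs₂ × zs₁ ⊆ reverse xs × zs₂ ⊆ ys
⊆-ʳ++-∷-split xs p with ⊆-++-split (reverse xs) (subst (_ ⊆_) (ʳ++-defn xs) p)
... | zs₁ , _ , refl , p₁ , _ ∷ʳ p₂   = inj₁ (subst (_ ⊆_) (sym (ʳ++-defn xs)) (++⁺ p₁ p₂))
... | zs₁ , _ , refl , p₁ , refl ∷ p₂ = inj₂ (zs₁ , _ , refl , p₁ , p₂)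

⊆-++-ʳ++ : ∀ xs → ys ʳ++ zs ⊆ (xs ++ ys) ʳ++ zs
⊆-++-ʳ++ {ys = ys} {zs} xs = subst (ys ʳ++ zs ⊆_) (sym (++-ʳ++ xs))
  (ʳ++⁺ (⊆-refl {x = ys}) (subst (zs ⊆_) (sym (ʳ++-defn xs)) (++⁺ˡ (reverse xs) ⊆-refl)))

deduplicate-⊆ : {R : Rel A ℓ} (R? : Decidable R) → ∀ xs → deduplicate R? xs ⊆ xs
deduplicate-⊆ R? []       = []
deduplicate-⊆ R? (x ∷ xs) = refl ∷ ⊆-trans (filter-⊆ _ _) (deduplicate-⊆ R? xs)

Unique⇒length≤ : Unique xs → All (_∈ ys) xs → length xs ≤ length ys
Unique⇒length≤ {xs = xs} {ys} u xs⊆ys = Fin.injective⇒≤ position-injective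
  where
  position : Fin (length xs) → Fin (length ys)
  position i = index (All.lookup xs⊆ys (∈-lookup i))

  position-injective : ∀ {i j} → position i ≡ position j → i ≡ j
  position-injective eq = Unique-lookup-injective u
    (index-injective (setoid _) (All.lookup xs⊆ys _) (All.lookup xs⊆ys _) eq)

Unique⇒length≤distinct : {s w : List ℕ} → Unique s → All (_∈ w) s → length s ≤ distinct w
Unique⇒length≤distinct u s⊆w = Unique⇒length≤ u (All.map (∈-deduplicate⁺ _≟_) s⊆w)

distinct-mono : {v w : List ℕ} → All (_∈ w) v → distinct v ≤ distinct w
distinct-mono {v} v⊆w = Unique⇒length≤distinct (deduplicate-! v)
  (All.tabulate (All.lookup v⊆w ∘ ∈-deduplicate⁻ _≟_ v))

deduplicate-increasing : AllPairs _≤_ xs → AllPairs _<_ (deduplicate _≟_ xs)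
deduplicate-increasing {xs = xs} sorted = AllPairs.zipWith (uncurry ≤∧≢⇒<)
  (AllPairs-resp-⊆ (deduplicate-⊆ _≟_ xs) sorted , deduplicate-! xs)

StrictlyIncreasing : ∀ {m n} → (Fin m → Fin n) → Set
StrictlyIncreasing α = ∀ i j → i Fin.< j → α i Fin.< α j

⊆⇒index-map : xs ⊆ ys →
  Σ[ α ∈ (Fin (length xs) → Fin (length ys)) ]
    StrictlyIncreasing α × (∀ i → lookup ys (α i) ≡ lookup xs i)
⊆⇒index-map [] = (λ ()) , (λ ()) , (λ ())
⊆⇒index-map (_ ∷ʳ p) with ⊆⇒index-map p
... | α , α↑ , α-lookup = suc ∘ α , (λ i j i<j → s<s (α↑ i j i<j)) , α-lookup
⊆⇒index-map (refl ∷ p) with ⊆⇒index-map p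
... | α , α↑ , α-lookup = Fin.lift 1 α , lift-α↑ , λ { zero → refl ; (suc i) → α-lookup i }
  where
  lift-α↑ : StrictlyIncreasing (Fin.lift 1 α)
  lift-α↑ zero    (suc j) _   = z<s
  lift-α↑ (suc i) (suc j) i<j = s<s (α↑ i j (ℕ.s<s⁻¹ i<j))

factor-through-suc : ∀ {m n} (α : Fin m → Fin (suc n)) → StrictlyIncreasing α →
  (∀ i → zero ≢ α i) → Σ[ β ∈ (Fin m → Fin n) ] StrictlyIncreasing β × (∀ i → α i ≡ suc (β i))
factor-through-suc α α↑ α≢0 = β , β↑ , α≡sucβ
  where
  β = λ i → punchOut (α≢0 i)
  α≡sucβ : ∀ i → α i ≡ suc (β i)
  α≡sucβ i = sym (Fin.punchIn-punchOut (α≢0 i))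
  β↑ : StrictlyIncreasing β
  β↑ i j i<j = ℕ.s<s⁻¹ (subst₂ Fin._<_ (α≡sucβ i) (α≡sucβ j) (α↑ i j i<j))

tabulate-lookup-⊆ : (ys : List A) {m : ℕ} (α : Fin m → Fin (length ys)) →
                    StrictlyIncreasing α → tabulate (lookup ys ∘ α) ⊆ ys
tabulate-lookup-∷-⊆ : (y : A) (ys : List A) {m : ℕ} (α : Fin m → Fin (suc (length ys))) →
                      StrictlyIncreasing α → (∀ i → zero ≢ α i) →
                      tabulate (lookup (y ∷ ys) ∘ α) ⊆ ys

tabulate-lookup-⊆ ys       {zero}  α α↑ = []⊆-universal ys
tabulate-lookup-⊆ []       {suc m} α α↑ = ⊥-elim (Fin.¬Fin0 (α zero))
tabulate-lookup-⊆ (y ∷ ys) {suc m} α α↑ with α zero Fin.≟ zero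
... | yes α₀≡0 = cong (lookup (y ∷ ys)) α₀≡0 ∷
  tabulate-lookup-∷-⊆ y ys (α ∘ suc) (λ i j → α↑ (suc i) (suc j) ∘ s<s)
    (λ i 0≡αᵢ → Fin.<⇒≢ (α↑ zero (suc i) z<s) (trans α₀≡0 0≡αᵢ))
... | no  α₀≢0 = y ∷ʳ tabulate-lookup-∷-⊆ y ys α α↑ α≢0
  where
  α≢0 : ∀ i → zero ≢ α i
  α≢0 zero         = α₀≢0 ∘ sym
  α≢0 (suc i) 0≡αᵢ = n≮0 (subst (α zero Fin.<_) (sym 0≡αᵢ) (α↑ zero (suc i) z<s))

tabulate-lookup-∷-⊆ y ys α α↑ α≢0 with factor-through-suc α α↑ α≢0
... | β , β↑ , α≡sucβ =
  subst (_⊆ ys) (tabulate-cong (cong (lookup (y ∷ ys)) ∘ sym ∘ α≡sucβ)) (tabulate-lookup-⊆ ys β β↑)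

≡-from-<⇔< : {x y u v : ℕ} → (x < y) ⇔ (u < v) → (y < x) ⇔ (v < u) → x ≡ y → u ≡ v
≡-from-<⇔< x<y⇔u<v y<x⇔v<u x≡y with <-cmp _ _
... | tri< u<v _ _ = contradiction (Equivalence.from x<y⇔u<v u<v) (<-irrefl x≡y)
... | tri≈ _ u≡v _ = u≡v
... | tri> _ _ v<u = contradiction (Equivalence.from y<x⇔v<u v<u) (<-irrefl (sym x≡y))

order-embedding⇒Contains : {w p : Word} (α : Fin (length p) → Fin (length w)) →
  StrictlyIncreasing α → (∀ i j → (lookup w (α i) < lookup w (α j)) ⇔ (lookup p i < lookup p j)) →
  Contains w p
order-embedding⇒Contains α α↑ order = α , α↑ , order , λ i j →
  mk⇔ (≡-from-<⇔< (order i j) (order j i)) (≡-from-<⇔< (⇔.sym (order i j)) (⇔.sym (order j i)))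

⊆⇒Contains : {s w : Word} → s ⊆ w → Contains w s
⊆⇒Contains {s} {w} occ with ⊆⇒index-map occ
... | α , α↑ , α-lookup = order-embedding⇒Contains {w} {s} α α↑ λ i j →
  subst₂ (λ u v → (u < v) ⇔ (lookup s i < lookup s j)) (sym (α-lookup i)) (sym (α-lookup j))
    (mk⇔ id id)

Contains-trans : {w s p : Word} → Contains w s → Contains s p → Contains w p
Contains-trans (α , α↑ , α-< , α-≡) (β , β↑ , β-< , β-≡) =
  α ∘ β , (λ i j → α↑ (β i) (β j) ∘ β↑ i j) ,
  (λ i j → ⇔.trans (α-< (β i) (β j)) (β-< i j)) , (λ i j → ⇔.trans (α-≡ (β i) (β j)) (β-≡ i j))

-- The two patterns as sublists

Has120 : Word → Set
Has120 w = ∃[ a ] ∃[ b ] ∃[ c ] a < b × b < c × b ∷ c ∷ a ∷ [] ⊆ w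

Decreasing : List ℕ → Set
Decreasing = AllPairs _>_

HasDecreasing : ℕ → Word → Set
HasDecreasing n w = ∃[ s ] n ≤ length s × Decreasing s × s ⊆ w

PatternFree : ℕ → Word → Set
PatternFree k w = ¬ Has120 w × ¬ HasDecreasing (suc k) w

PatternFree-⊆ : {v w : Word} → v ⊆ w → PatternFree k w → PatternFree k v
PatternFree-⊆ v⊆w (no120 , noDecreasing) =
  (λ (a , b , c , a<b , b<c , occ) → no120 (a , b , c , a<b , b<c , ⊆-trans occ v⊆w)) ,
  (λ (s , long , dec , occ) → noDecreasing (s , long , dec , ⊆-trans occ v⊆w))

bca-contains-p120 : {a b c : ℕ} → a < b → b < c → Contains (b ∷ c ∷ a ∷ []) p120
bca-contains-p120 {a} {b} {c} a<b b<c =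
  order-embedding⇒Contains {b ∷ c ∷ a ∷ []} {p120} id (λ _ _ → id) order
  where
  both : {P Q : Set} → P → Q → P ⇔ Q
  both p q = mk⇔ (λ _ → q) (λ _ → p)
  neither : {P Q : Set} → ¬ P → ¬ Q → P ⇔ Q
  neither ¬p ¬q = mk⇔ (⊥-elim ∘ ¬p) (⊥-elim ∘ ¬q)
  a<c = <-trans a<b b<c
  order : ∀ i j → (lookup (b ∷ c ∷ a ∷ []) i < lookup (b ∷ c ∷ a ∷ []) j)
                  ⇔ (lookup p120 i < lookup p120 j)
  order zero             zero             = neither (<-irrefl refl) (<-irrefl refl)
  order zero             (suc zero)       = both b<c (s<s z<s)
  order zero             (suc (suc zero)) = neither (<-asym a<b) λ ()
  order (suc zero)       zero             = neither (<-asym b<c) λ { (s<s ()) }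
  order (suc zero)       (suc zero)       = neither (<-irrefl refl) (<-irrefl refl)
  order (suc zero)       (suc (suc zero)) = neither (<-asym a<c) λ ()
  order (suc (suc zero)) zero             = both a<b z<s
  order (suc (suc zero)) (suc zero)       = both a<c z<s
  order (suc (suc zero)) (suc (suc zero)) = neither (<-irrefl refl) (<-irrefl refl)

Contains-p120⇔Has120 : {w : Word} → Contains w p120 ⇔ Has120 w
Contains-p120⇔Has120 {w} = mk⇔ to from
  where
  to : Contains w p120 → Has120 w
  to (α , α↑ , order , _) =
    _ , _ , _ , Equivalence.from (order (suc (suc zero)) zero) z<s ,
    Equivalence.from (order zero (suc zero)) (s<s z<s) , tabulate-lookup-⊆ w α α↑
  from : Has120 w → Contains w p120
  from (a , b , c , a<b , b<c , occ) =
    Contains-trans {w} {b ∷ c ∷ a ∷ []} {p120} (⊆⇒Contains occ) (bca-contains-p120 a<b b<c)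

Decreasing-lookup-< : {s : List ℕ} → Decreasing s → ∀ {i j} →
                      (lookup s i < lookup s j) ⇔ (j Fin.< i)
Decreasing-lookup-< {s} dec {i} {j} = mk⇔ to (AllPairs-lookup dec)
  where
  to : lookup s i < lookup s j → j Fin.< i
  to sᵢ<sⱼ with Fin.<-cmp i j
  ... | tri< i<j _ _  = contradiction (AllPairs-lookup dec i<j) (<-asym sᵢ<sⱼ)
  ... | tri≈ _ refl _ = contradiction sᵢ<sⱼ (<-irrefl refl)
  ... | tri> _ _ j<i  = j<i

Decreasing-contains : {s p : List ℕ} → Decreasing s → Decreasing p → length p ≤ length s →
                      Contains s p
Decreasing-contains {s} {p} dec-s dec-p p≤s =
  order-embedding⇒Contains {s} {p} ι (λ i j → Equivalence.from ι-order) order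
  where
  ι : Fin (length p) → Fin (length s)
  ι i = inject≤ i p≤s
  ι-order : ∀ {i j} → (ι i Fin.< ι j) ⇔ (i Fin.< j)
  ι-order {i} {j} = subst₂ (λ u v → (u < v) ⇔ (i Fin.< j))
    (sym (Fin.toℕ-inject≤ i p≤s)) (sym (Fin.toℕ-inject≤ j p≤s)) (mk⇔ id id)
  order : ∀ i j → (lookup s (ι i) < lookup s (ι j)) ⇔ (lookup p i < lookup p j)
  order i j =
    ⇔.trans (Decreasing-lookup-< dec-s) (⇔.trans ι-order (⇔.sym (Decreasing-lookup-< dec-p)))

decPattern≡downFrom : ∀ k → decPattern k ≡ downFrom (suc k)
decPattern≡downFrom k = reverse-applyUpTo id (suc k)

decPattern-decreasing : ∀ k → Decreasing (decPattern k)
decPattern-decreasing k = subst Decreasing (sym (decPattern≡downFrom k))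
  (AllPairs.applyDownFrom⁺₁ id (suc k) (λ j<i _ → j<i))

length-decPattern : ∀ k → length (decPattern k) ≡ suc k
length-decPattern k = trans (cong length (decPattern≡downFrom k)) (length-downFrom (suc k))

Contains-decPattern⇔HasDecreasing : {w : Word} →
                                    Contains w (decPattern k) ⇔ HasDecreasing (suc k) w
Contains-decPattern⇔HasDecreasing {k} {w} = mk⇔ to from
  where
  to : Contains w (decPattern k) → HasDecreasing (suc k) w
  to (α , α↑ , order , _) =
    tabulate (lookup w ∘ α) ,
    ≤-reflexive (sym (trans (length-tabulate _) (length-decPattern k))) ,
    AllPairs.tabulate⁺-< (λ i<j →
      Equivalence.from (order _ _) (AllPairs-lookup (decPattern-decreasing k) i<j)) ,
    tabulate-lookup-⊆ w α α↑
  from : HasDecreasing (suc k) w → Contains w (decPattern k)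
  from (s , long , dec , occ) = Contains-trans {w} {s} {decPattern k} (⊆⇒Contains occ)
    (Decreasing-contains dec (decPattern-decreasing k)
      (subst (_≤ length s) (sym (length-decPattern k)) long))

-- Necessity

remaining-output : Star (Step k) ⟨ inp , st , out ⟩ ⟨ [] , [] , fin ⟩ →
                   ∃[ rest ] fin ≡ out ++ rest × rest ↭ st ++ inp
remaining-output ε = [] , sym (++-identityʳ _) , ↭-refl
remaining-output {inp = x ∷ inp} {st} (push _ ◅ run) with remaining-output run
... | rest , fin≡ , rest↭ = rest , fin≡ , ↭-trans rest↭ (↭-sym (shift x st inp))
remaining-output {out = out} (pop {x = x} ◅ run) with remaining-output run
... | rest , fin≡ , rest↭ = x ∷ rest , trans fin≡ (++-assoc out [ x ] rest) , prep x rest↭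

popped-is-minimal : {x : ℕ} → Star (Step k) ⟨ inp , st , out ++ [ x ] ⟩ ⟨ [] , [] , fin ⟩ →
                    AllPairs _≤_ fin → All (x ≤_) (st ++ inp)
popped-is-minimal {out = out} {x = x} run sorted with remaining-output run
... | rest , refl , rest↭ = All-resp-↭ rest↭
  (AllPairs.head (AllPairs-++⁻ʳ out (subst (AllPairs _≤_) (++-assoc out [ x ] rest) sorted)))

pop-keeps-no120 : {x : ℕ} → AllPairs _≤_ st → All (x ≤_) inp →
                  ¬ Has120 (st ʳ++ inp) → ¬ Has120 (st ʳ++ x ∷ inp)
pop-keeps-no120 {st} sorted x≤inp no120 (a , b , c , a<b , b<c , occ)
  with ⊆-ʳ++-∷-split st occ
... | inj₁ old = no120 (a , b , c , a<b , b<c , old)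
... | inj₂ ([] , _ , refl , _ , later) =
  <⇒≱ a<b (All.head (All.tail (All-resp-⊆ later x≤inp)))
... | inj₂ (_ ∷ [] , _ , refl , _ , later) =
  <⇒≱ (<-trans a<b b<c) (All.head (All-resp-⊆ later x≤inp))
... | inj₂ (_ ∷ _ ∷ [] , _ , refl , below , _)
  with AllPairs-resp-⊆ (reverse⁻ {as = c ∷ b ∷ []} below) sorted
...   | (c≤b ∷ []) ∷ _ = <⇒≱ b<c c≤b
pop-keeps-no120 _ _ _ _ | inj₂ (_ ∷ _ ∷ _ ∷ []    , _ , () , _)
pop-keeps-no120 _ _ _ _ | inj₂ (_ ∷ _ ∷ _ ∷ _ ∷ _ , _ , () , _)

pop-keeps-noDecreasing : {x : ℕ} → distinct (x ∷ st) ≤ k → All (x ≤_) inp →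
  ¬ HasDecreasing (suc k) (st ʳ++ inp) → ¬ HasDecreasing (suc k) (st ʳ++ x ∷ inp)
pop-keeps-noDecreasing {st} {x = x} depth x≤inp noDecreasing (s , long , dec , occ)
  with ⊆-ʳ++-∷-split st occ
... | inj₁ old = noDecreasing (s , long , dec , old)
... | inj₂ (s₁ , _ ∷ _ , refl , _ , later) =
  <⇒≱ (All.head (AllPairs.head (AllPairs-++⁻ʳ s₁ dec))) (All.head (All-resp-⊆ later x≤inp))
... | inj₂ (s₁ , [] , refl , below , _) = 1+n≰n (≤-trans long (≤-trans on-stack depth))
  where
  on-stack : length (s₁ ++ [ x ]) ≤ distinct (x ∷ st)
  on-stack = Unique⇒length≤distinct {w = x ∷ st} (AllPairs.map >⇒≢ dec)
    (All.++⁺ (All.tabulate (there ∘ Any.reverse⁻ ∘ Any-resp-⊆ below)) (here refl ∷ []))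

-- A push leaves st ʳ++ inp unchanged: (x ∷ st) ʳ++ inp reduces to st ʳ++ x ∷ inp.
sorting-run-invariant : Star (Step k) ⟨ inp , st , out ⟩ ⟨ [] , [] , fin ⟩ → AllPairs _≤_ fin →
                        distinct st ≤ k → AllPairs _≤_ st × PatternFree k (st ʳ++ inp)
sorting-run-invariant ε _ _ =
  [] , (λ { (_ , _ , _ , _ , _ , ()) }) , λ { ([] , () , _) ; (_ ∷ _ , _ , _ , ()) }
sorting-run-invariant (push depth ◅ run) sorted _ with sorting-run-invariant run sorted depth
... | _ ∷ st-sorted , free = st-sorted , free
sorting-run-invariant {st = x ∷ st} (pop ◅ run) sorted depth
  with sorting-run-invariant run sorted
         (≤-trans (distinct-mono {st} {x ∷ st} (All.tabulate there)) depth)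
... | st-sorted , no120 , noDecreasing =
  x≤st ∷ st-sorted ,
  pop-keeps-no120 st-sorted x≤inp no120 ,
  pop-keeps-noDecreasing {st} depth x≤inp noDecreasing
  where
  x≤st = All.++⁻ˡ st (popped-is-minimal run sorted)
  x≤inp = All.++⁻ʳ st (popped-is-minimal run sorted)

sortable⇒patternFree : {w : Word} → Sortable k w → PatternFree k w
sortable⇒patternFree (_ , run , sorted) =
  proj₂ (sorting-run-invariant run (Linked⇒AllPairs ≤-trans sorted) z≤n)

-- Sufficiency

pops : ∀ xs → Star (Step k) ⟨ inp , xs ++ st , out ⟩ ⟨ inp , st , out ++ xs ⟩
pops {out = out} [] rewrite ++-identityʳ out = ε
pops {out = out} (x ∷ xs) rewrite sym (++-assoc out [ x ] xs) = pop ◅ pops xs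

_≤*_ : List ℕ → List ℕ → Set
xs ≤* ys = All (λ x → All (x ≤_) ys) xs

record GreedyInvariant (k : ℕ) (inp st out : List ℕ) : Set where
  constructor greedyInvariant
  field
    sorted  : AllPairs _≤_ (out ++ st)
    settled : out ≤* inp
    free    : PatternFree k (st ʳ++ inp)

split-below : ∀ x st → AllPairs _≤_ st →
              ∃₂ λ lo hi → st ≡ lo ++ hi × All (_< x) lo × All (x ≤_) hi
split-below x []       _                  = [] , [] , refl , [] , []
split-below x (t ∷ st) (t≤st ∷ st-sorted) with t <? x | split-below x st st-sorted
... | yes t<x | lo , hi , refl , lo<x , x≤hi = t ∷ lo , hi , refl , t<x ∷ lo<x , x≤hi
... | no  t≮x | _ = [] , t ∷ st , refl , [] , ≮⇒≥ t≮x ∷ All.map (≤-trans (≮⇒≥ t≮x)) t≤st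

popped-below-input : {x t : ℕ} → ¬ Has120 (st ʳ++ x ∷ inp) → t ∈ st → t < x → All (t ≤_) inp
popped-below-input {st} no120 t∈st t<x = All.tabulate λ y∈inp → ≮⇒≥ λ y<t →
  no120 (_ , _ , _ , y<t , t<x , subst (_ ⊆_) (sym (ʳ++-defn st))
    (++⁺ (from∈ (Any.reverse⁺ t∈st)) (refl ∷ from∈ y∈inp)))

sorted-stack-decreasing : {n : ℕ} → AllPairs _≤_ st → n ≤ distinct st →
                          HasDecreasing n (st ʳ++ inp)
sorted-stack-decreasing {st} {inp} sorted n≤ =
  reverse (deduplicate _≟_ st) ,
  ≤-trans n≤ (≤-reflexive (sym (length-reverse (deduplicate _≟_ st)))) ,
  AllPairs-reverse⁺ (deduplicate-increasing sorted) ,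
  ʳ++⁺ (deduplicate-⊆ _≟_ st) ([]⊆-universal inp)

greedy-step : {x : ℕ} → GreedyInvariant k (x ∷ inp) st out →
  ∃₂ λ st′ out′ → Star (Step k) ⟨ x ∷ inp , st , out ⟩ ⟨ inp , st′ , out′ ⟩
                × GreedyInvariant k inp st′ out′
greedy-step {k} {inp} {st} {out} {x} (greedyInvariant sorted settled free)
  with split-below x st (AllPairs-++⁻ʳ out sorted)
... | lo , hi , refl , lo<x , x≤hi with distinct (x ∷ hi) ≤? k
...   | no too-deep = ⊥-elim (proj₂ (PatternFree-⊆ (⊆-++-ʳ++ lo) free)
        (sorted-stack-decreasing (x≤hi ∷ AllPairs-++⁻ʳ lo (AllPairs-++⁻ʳ out sorted))
          (≰⇒> too-deep)))
...   | yes depth = x ∷ hi , out ++ lo , pops lo ◅◅ (push depth ◅ ε) , record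
  { sorted  = AllPairs-insert (out ++ lo) (subst (AllPairs _≤_) (sym (++-assoc out lo hi)) sorted)
                (All.++⁺ (All.map All.head settled) (All.map <⇒≤ lo<x)) x≤hi
  ; settled = All.++⁺ (All.map All.tail settled) (All.tabulate λ t∈lo →
                popped-below-input (proj₁ free) (Any.++⁺ˡ t∈lo) (All.lookup lo<x t∈lo))
  ; free    = PatternFree-⊆ (⊆-++-ʳ++ lo) free
  }

greedy-run : ∀ inp → GreedyInvariant k inp st out →
             ∃[ fin ] Star (Step k) ⟨ inp , st , out ⟩ ⟨ [] , [] , fin ⟩ × AllPairs _≤_ fin
greedy-run {k} {st} {out} [] I =
  out ++ st ,
  subst (λ s → Star (Step k) ⟨ [] , s , out ⟩ ⟨ [] , [] , out ++ st ⟩) (++-identityʳ st) (pops st) ,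
  GreedyInvariant.sorted I
greedy-run (x ∷ inp) I with greedy-step I
... | _ , _ , steps , I′ with greedy-run inp I′
... | fin , run , sorted = fin , steps ◅◅ run , sorted

patternFree⇒sortable : {w : Word} → PatternFree k w → Sortable k w
patternFree⇒sortable {w = w} free with greedy-run w (greedyInvariant [] [] free)
... | fin , run , sorted = fin , run , AllPairs⇒Linked sorted

Sortable⇔PatternFree : {w : Word} → Sortable k w ⇔ PatternFree k w
Sortable⇔PatternFree = mk⇔ sortable⇒patternFree patternFree⇒sortable

¬-cong : {P Q : Set} → P ⇔ Q → (¬ P) ⇔ (¬ Q)
¬-cong P⇔Q = mk⇔ (_∘ Equivalence.from P⇔Q) (_∘ Equivalence.to P⇔Q)

Avoids⇔PatternFree : {w : Word} → (Avoids w p120 × Avoids w (decPattern k)) ⇔ PatternFree k w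
Avoids⇔PatternFree = ¬-cong Contains-p120⇔Has120 ×-⇔ ¬-cong Contains-decPattern⇔HasDecreasing

mainTheorem12 : (k : ℕ) → 1 ≤ k → (w : Word) →
    Sortable k w ⇔ (Avoids w p120 × Avoids w (decPattern k))
mainTheorem12 k _ w = ⇔.trans Sortable⇔PatternFree (⇔.sym Avoids⇔PatternFree)
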